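{- Let $V$ be an infinite set, $H=\langle V,E^*\rangle$ a graph, $n\in\omega$, and $w:V\times\mathcal P(E^*)\to\{0,\dots,n\}$ a non-trivial, finitely determined and bounded function. Then $w$ is (a) monotone: $E_0\subseteq E_1\subseteq E^*$ implies $w(a,E_0)\le w(a,E_1)$ for all $a\in V$; (b) continuous: for every ordinal $\mu$ and every $\subseteq$-increasing sequence $\langle E_\alpha:\alpha<\mu\rangle$ of subsets of $E^*$, $w(a,\bigcup_{\alpha<\mu}E_\alpha)=\max_{\alpha<\mu}w(a,E_\alpha)$ for all $a\in V$; (c) stable: if $E\subseteq E^*$, $e=\{a,b\}\in E^*$ and $w(a,E)=w(b,E)=n$, then $w(c,E\cup\{e\})=w(c,E)$ for every $c\in V$.
   Context: Non-trivial: $w(a,\emptyset)=0$ and $w(a,E^*)=n$ for all $a\in V$. Finitely determined: $w(a,E)=\max\{w(a,E'):E'\subseteq E\text{ finite}\}$ for all $E\subseteq E^*$, $a\in V$. Bounded: there are $M\in\omega$ and $W:V\times\mathcal P(E^*)\to[V]^{\le M}$ such that (i) for all $a,b\in V$, $E\subseteq E^*$: $a\in W(a,E)$, and $a\in W(b,E)$ implies $W(a,E)=W(b,E)$ and $w(a,E)=w(b,E)$; (ii) if $E\subseteq E'\subseteq E^*$, $a\in V$ and $w(a,E)<w(a,E')$, then $E'\setminus E$ contains a pair with one endpoint in $W(a,E)$. -}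

module Defs where

open import Data.Nat using (ℕ; _≤_; _<_)
open import Data.Product using (Σ; ∃; ∃-syntax; _×_; _,_)
open import Data.Sum using (_⊎_)
open import Data.Empty using (⊥)
open import Data.List using (List; length)
open import Data.List.Membership.Propositional using (_∈_)
open import Relation.Nullary using (¬_)
open import Relation.Binary.PropositionalEquality using (_≡_)
open import Relation.Binary.Definitions using (Transitive; Trichotomous)
open import Induction.WellFounded using (WellFounded)

-- A set of (undirected) edges on V is represented as a binary predicate
-- R x y meaning "{x,y} is in the set"; genuine edge sets are symmetric.
EdgePred : Set → Set₁
EdgePred V = V → V → Set

Infinite : Set → Set
Infinite A = ¬ (∃[ xs ] (∀ (v : A) → v ∈ xs))

module _ {V : Set} where

  _⊆ₑ_ : EdgePred V → EdgePred V → Set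
  E ⊆ₑ F = ∀ x y → E x y → F x y

  _≐_ : EdgePred V → EdgePred V → Set
  E ≐ F = (E ⊆ₑ F) × (F ⊆ₑ E)

  Symmetric : EdgePred V → Set
  Symmetric E = ∀ x y → E x y → E y x

  IsGraph : EdgePred V → Set
  IsGraph E* = Symmetric E* × (∀ x → ¬ E* x x)

  -- E ∈ 𝒫(E*): E is a set of edges (symmetric predicate) contained in E*
  SubsetOf : EdgePred V → EdgePred V → Set
  SubsetOf E* E = Symmetric E × (E ⊆ₑ E*)

  ∅ₑ : EdgePred V
  ∅ₑ x y = ⊥

  fromList : List (V × V) → EdgePred V
  fromList l x y = ((x , y) ∈ l) ⊎ ((y , x) ∈ l)

  insertEdge : V → V → EdgePred V → EdgePred V
  insertEdge a b E x y = E x y ⊎ ((x ≡ a × y ≡ b) ⊎ (x ≡ b × y ≡ a))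

  ⋃ₑ : {I : Set} → (I → EdgePred V) → EdgePred V
  ⋃ₑ {I} F x y = ∃[ i ] F i x y

  module _ (E* : EdgePred V) (n : ℕ) (w : V → EdgePred V → ℕ) where

    -- w is a function on sets: it respects extensional equality of edge sets
    Extensional : Set₁
    Extensional = ∀ E F → SubsetOf E* E → SubsetOf E* F → E ≐ F → ∀ a → w a E ≡ w a F

    ValuedIn : Set₁
    ValuedIn = ∀ E → SubsetOf E* E → ∀ a → w a E ≤ n

    NonTrivial : Set
    NonTrivial = ∀ a → (w a ∅ₑ ≡ 0) × (w a E* ≡ n)

    -- finite subsets of E : lists of pairs whose induced edge set lies in E
    -- w(a,E) = max { w(a,E') : E' ⊆ E finite }
    FinitelyDetermined : Set₁
    FinitelyDetermined = ∀ E → SubsetOf E* E → ∀ a →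
      (∀ (l : List (V × V)) → fromList l ⊆ₑ E → w a (fromList l) ≤ w a E)
      × (∃[ l ] ((fromList l ⊆ₑ E) × (w a (fromList l) ≡ w a E)))

    Bounded : Set₁
    Bounded = Σ ℕ λ M → Σ (V → EdgePred V → List V) λ W → (
        (∀ a E → length (W a E) ≤ M)
      × (∀ E → SubsetOf E* E →
           ∀ a b → (a ∈ W a E)
                 × (a ∈ W b E → (∀ x → (x ∈ W a E → x ∈ W b E) × (x ∈ W b E → x ∈ W a E))
                               × (w a E ≡ w b E)))
      × (∀ E E' → SubsetOf E* E → SubsetOf E* E' → E ⊆ₑ E' → ∀ a →
           w a E < w a E' →
           ∃[ x ] ∃[ y ] (E' x y × ¬ E x y × ((x ∈ W a E) ⊎ (y ∈ W a E)))))

    Monotone : Set₁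
    Monotone = ∀ E₀ E₁ → SubsetOf E* E₀ → SubsetOf E* E₁ → E₀ ⊆ₑ E₁ →
      ∀ a → w a E₀ ≤ w a E₁

    -- An ordinal μ is represented by a type I with a strict well-order _≺_.
    -- max over α<μ of values in {0,…,n}: an upper bound which is attained,
    -- with max ∅ = 0 (covers μ = 0).
    Continuous : Set₁
    Continuous = ∀ (I : Set) (_≺_ : I → I → Set) →
      Transitive _≺_ → Trichotomous _≡_ _≺_ → WellFounded _≺_ →
      ∀ (F : I → EdgePred V) → (∀ α → SubsetOf E* (F α)) →
      (∀ α β → α ≺ β → F α ⊆ₑ F β) →
      ∀ a → (∀ α → w a (F α) ≤ w a (⋃ₑ F))
          × ((∃[ α ] (w a (F α) ≡ w a (⋃ₑ F))) ⊎ (w a (⋃ₑ F) ≡ 0))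

    Stable : Set₁
    Stable = ∀ E → SubsetOf E* E → ∀ a b → E* a b →
      w a E ≡ n → w b E ≡ n → ∀ c → w c (insertEdge a b E) ≡ w c E

{-# OPTIONS --safe #-}
-- Monotonicity is immediate from finite determinacy: a finite witness for
-- w(a,E₀) is also a finite subset of E₁. For continuity, a finite witness for
-- the union of a chain lies, by trichotomy, inside a single member of the
-- chain. For stability, if adding e = {a,b} raised w(c,E), the bound says
-- some endpoint of e lies in the cell W(c,E), on which w(·,E) is constant;
-- so w(c,E) = n already, and w(c,E ∪ {e}) ≤ n cannot exceed it.
module Submission where

open import Defs
open import Data.Nat using (ℕ; _≤_; _<_)
open import Data.Nat.Properties using (≤-antisym; <⇒≱; ≮⇒≥)
open import Data.Product using (_×_; _,_; proj₁; proj₂; ∃-syntax)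
open import Data.Sum using (_⊎_; inj₁; inj₂)
open import Data.Empty using (⊥-elim)
open import Data.List using (List; []; _∷_)
open import Data.List.Membership.Propositional using (_∈_)
open import Data.List.Relation.Unary.Any using (here; there)
open import Relation.Binary.PropositionalEquality using (_≡_; refl; sym; trans; subst)
open import Relation.Binary.Definitions using (Trichotomous; tri<; tri≈; tri>)

module _ {A I : Set} {_≺_ : I → I → Set} (tri : Trichotomous _≡_ _≺_)
         (F : I → A → Set) (increasing : ∀ α β → α ≺ β → ∀ x → F α x → F β x) where

  finite⊆⋃⇒⊆member : (l : List A) → (∀ x → x ∈ l → ∃[ α ] F α x) →
                     (l ≡ []) ⊎ (∃[ α ] (∀ x → x ∈ l → F α x))
  finite⊆⋃⇒⊆member [] _ = inj₁ refl
  finite⊆⋃⇒⊆member (x ∷ l) covered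
    with covered x (here refl) | finite⊆⋃⇒⊆member l (λ y y∈l → covered y (there y∈l))
  ... | α , Fαx | inj₁ refl = inj₂ (α , λ { _ (here refl) → Fαx })
  ... | α , Fαx | inj₂ (β , Fβl) with tri α β
  ...   | tri< α≺β _ _ = inj₂ (β , λ { _ (here refl) → increasing α β α≺β x Fαx
                                     ; y (there y∈l) → Fβl y y∈l })
  ...   | tri≈ _ refl _ = inj₂ (α , λ { _ (here refl) → Fαx ; y (there y∈l) → Fβl y y∈l })
  ...   | tri> _ _ β≺α = inj₂ (α , λ { _ (here refl) → Fαx
                                     ; y (there y∈l) → increasing β α β≺α y (Fβl y y∈l) })

fromList[]≐∅ₑ : {V : Set} → fromList {V} [] ≐ ∅ₑ
fromList[]≐∅ₑ = (λ { _ _ (inj₁ ()) ; _ _ (inj₂ ()) }) , (λ _ _ ())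

module _ {V : Set} {E* : EdgePred V} where

  ∅ₑ-subset : SubsetOf E* ∅ₑ
  ∅ₑ-subset = (λ _ _ ()) , (λ _ _ ())

  fromList[]-subset : SubsetOf E* (fromList [])
  fromList[]-subset = (λ { _ _ (inj₁ ()) ; _ _ (inj₂ ()) }) , (λ { _ _ (inj₁ ()) ; _ _ (inj₂ ()) })

  ⋃ₑ-subset : {I : Set} (F : I → EdgePred V) → (∀ α → SubsetOf E* (F α)) → SubsetOf E* (⋃ₑ F)
  ⋃ₑ-subset F sub = (λ { x y (α , p) → α , proj₁ (sub α) x y p })
                  , (λ { x y (α , p) → proj₂ (sub α) x y p })

  insertEdge-subset : Symmetric E* → ∀ {E a b} → SubsetOf E* E → E* a b →
                      SubsetOf E* (insertEdge a b E)
  insertEdge-subset symE* {a = a} {b} (symE , E⊆E*) ab∈E* =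
      (λ { x y (inj₁ p) → inj₁ (symE x y p)
         ; _ _ (inj₂ (inj₁ (refl , refl))) → inj₂ (inj₂ (refl , refl))
         ; _ _ (inj₂ (inj₂ (refl , refl))) → inj₂ (inj₁ (refl , refl)) })
    , (λ { x y (inj₁ p) → E⊆E* x y p
         ; _ _ (inj₂ (inj₁ (refl , refl))) → ab∈E*
         ; _ _ (inj₂ (inj₂ (refl , refl))) → symE* a b ab∈E* })

module _ {V : Set} (E* : EdgePred V) (n : ℕ) (w : V → EdgePred V → ℕ) where

  finitelyDetermined⇒monotone : FinitelyDetermined E* n w → Monotone E* n w
  finitelyDetermined⇒monotone fd E₀ E₁ s₀ s₁ E₀⊆E₁ a with fd E₀ s₀ a
  ... | _ , (l , l⊆E₀ , wl≡wE₀) =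
    subst (_≤ w a E₁) wl≡wE₀ (proj₁ (fd E₁ s₁ a) l (λ x y p → E₀⊆E₁ x y (l⊆E₀ x y p)))

  finitelyDetermined⇒continuous : Extensional E* n w → NonTrivial E* n w →
                                  FinitelyDetermined E* n w → Continuous E* n w
  finitelyDetermined⇒continuous ext nt fd _ _ _ tri _ F sub increasing a =
    below , attained
    where
      s⋃ : SubsetOf E* (⋃ₑ F)
      s⋃ = ⋃ₑ-subset F sub

      below : ∀ α → w a (F α) ≤ w a (⋃ₑ F)
      below α = finitelyDetermined⇒monotone fd (F α) (⋃ₑ F) (sub α) s⋃ (λ _ _ p → α , p) a

      attained : (∃[ α ] (w a (F α) ≡ w a (⋃ₑ F))) ⊎ (w a (⋃ₑ F) ≡ 0)
      attained with fd (⋃ₑ F) s⋃ a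
      ... | _ , (l , l⊆⋃ , wl≡w⋃)
          with finite⊆⋃⇒⊆member tri (λ α p → F α (proj₁ p) (proj₂ p))
                 (λ α β α≺β p → increasing α β α≺β (proj₁ p) (proj₂ p))
                 l (λ p p∈l → l⊆⋃ _ _ (inj₁ p∈l))
      ... | inj₁ refl = inj₂ (trans (sym wl≡w⋃)
              (trans (ext (fromList []) ∅ₑ fromList[]-subset ∅ₑ-subset fromList[]≐∅ₑ a) (proj₁ (nt a))))
      ... | inj₂ (α , l⊆Fα) = inj₁ (α , ≤-antisym (below α)
              (subst (_≤ w a (F α)) wl≡w⋃ (proj₁ (fd (F α) (sub α) a) l
                 (λ { x y (inj₁ p∈l) → l⊆Fα _ p∈l
                    ; x y (inj₂ p∈l) → proj₁ (sub α) y x (l⊆Fα _ p∈l) }))))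

  cell : Bounded E* n w → V → EdgePred V → List V
  cell (_ , W , _) = W

  cell-value : (bounded : Bounded E* n w) → ∀ {E} → SubsetOf E* E →
               ∀ {u c} → u ∈ cell bounded c E → w c E ≡ w u E
  cell-value (_ , _ , _ , cells , _) sE {u} {c} u∈Wc = sym (proj₂ (proj₂ (cells _ sE u c) u∈Wc))

  insertEdge-growth⇒endpoint∈cell :
    (bounded : Bounded E* n w) → ∀ {E a b c} → SubsetOf E* E → SubsetOf E* (insertEdge a b E) →
    w c E < w c (insertEdge a b E) → (a ∈ cell bounded c E) ⊎ (b ∈ cell bounded c E)
  insertEdge-growth⇒endpoint∈cell (_ , _ , _ , _ , growth) sE sE' lt
    with growth _ _ sE sE' (λ _ _ → inj₁) _ lt
  ... | _ , _ , inj₁ p , p∉E , _ = ⊥-elim (p∉E p)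
  ... | _ , _ , inj₂ (inj₁ (refl , refl)) , _ , endpoint = endpoint
  ... | _ , _ , inj₂ (inj₂ (refl , refl)) , _ , inj₁ b∈ = inj₂ b∈
  ... | _ , _ , inj₂ (inj₂ (refl , refl)) , _ , inj₂ a∈ = inj₁ a∈

  bounded⇒stable : Bounded E* n w → Symmetric E* → ValuedIn E* n w → Monotone E* n w →
                   Stable E* n w
  bounded⇒stable bounded symE* val mono E sE a b ab∈E* wa≡n wb≡n c =
    ≤-antisym notRaised (mono _ _ sE sE' (λ _ _ → inj₁) c)
    where
      E' : EdgePred V
      E' = insertEdge a b E

      sE' : SubsetOf E* E'
      sE' = insertEdge-subset symE* sE ab∈E*

      raised⇒wc≡n : w c E < w c E' → w c E ≡ n
      raised⇒wc≡n lt with insertEdge-growth⇒endpoint∈cell bounded sE sE' lt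
      ... | inj₁ a∈ = trans (cell-value bounded sE a∈) wa≡n
      ... | inj₂ b∈ = trans (cell-value bounded sE b∈) wb≡n

      notRaised : w c E' ≤ w c E
      notRaised = ≮⇒≥ λ lt → <⇒≱ lt (subst (w c E' ≤_) (sym (raised⇒wc≡n lt)) (val E' sE' c))

proposition3p13 : (V : Set) (E* : EdgePred V) (n : ℕ) (w : V → EdgePred V → ℕ) →
    Infinite V → IsGraph E* →
    Extensional E* n w → ValuedIn E* n w →
    NonTrivial E* n w → FinitelyDetermined E* n w → Bounded E* n w →
    Monotone E* n w × Continuous E* n w × Stable E* n w
proposition3p13 V E* n w _ (symE* , _) ext val nt fd bounded =
  mono , finitelyDetermined⇒continuous E* n w ext nt fd
       , bounded⇒stable E* n w bounded symE* val mono
  where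
    mono : Monotone E* n w
    mono = finitelyDetermined⇒monotone E* n w fd
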